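{- For every function $f:\mathbb{N}\to\{0,1\}$, the language $L_f=\{\texttt{a}^n: f(n)=1\}$ can be computed by the evolving sequence of ex-machines $\mathfrak{Q}(x)\to\mathfrak{Q}(f(0)\,x)\to\mathfrak{Q}(f(0)f(1)\,x)\to\cdots\to\mathfrak{Q}(f(0)f(1)\dots f(n)\,x)\to\cdots$; that is, this sequence is an evolutionary path of $\mathfrak{Q}(x)$, and for every $n$ and every $k\ge n$, $\texttt{a}^n$ is in the language of $\mathfrak{Q}(f(0)\dots f(k)\,x)$ if and only if $f(n)=1$ (and is not in it if and only if $f(n)=0$).
   Context: Ex-machines. An ex-machine has a finite set of states $Q=\{0,1,\dots,|Q|-1\}\subset\mathbb{N}$ (which may grow during execution), a halting state $h$, a finite alphabet $A$ containing $\texttt{0},\texttt{1}$ and the blank $\texttt{\#}$, a tape $T:\mathbb{Z}\to A$ that is finitely bounded (blank outside a finite set), a tape head position $k\in\mathbb{Z}$, and a finite instruction set $\mathcal{I}$ in which no two instructions share both their first coordinate (state) and second coordinate (scanned symbol). The machine in state $q$ scanning $a=T(k)$ executes the unique instruction with first two coordinates $(q,a)$; it halts when it enters $h$. Instruction types: (1) standard instruction $(q,a,r,\alpha,y)$ with $y\in\{ -1,0,1\}$: set $T(k)=\alpha$, move to state $r$, move the head to $k+y$. (2) quantum random instruction $(q,a,r,y)$: measure a quantum random bit $b\in\{0,1\}$, set $T(k)=b$, move to state $r$, move the head to $k+y$. (3) meta instruction $(q,a,r,\alpha,y,J)$ with $J$ a standard or quantum random instruction: execute $(q,a,r,\alpha,y)$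 as a standard instruction, then if $\mathcal{I}$ contains an instruction with the same first two coordinates as $J$, replace it by $J$, otherwise add $J$ to $\mathcal{I}$. State entries of instructions may be written symbolically as $|Q|$ or $|Q|-1$; when an instruction is executed, all its symbolic entries (including those inside $J$) are instantiated with the current number of states $|Q|$ at the start of that step, and if the target state equals $|Q|$ then the new state $|Q|$ is added to $Q$. An instruction whose first coordinate is the symbol $|Q|-1$ (a simple meta instruction) applies when the machine is in state $|Q|-1$ scanning the given symbol and no instruction with those concrete first two coordinates exists; when executed, its instantiated version is executed and added to $\mathcal{I}$. Quantum random bits are assumed to be independent unbiased Bernoulli trials: each bit is $0$ or $1$ with probability $1/2$, independently of all previous bits. If ex-machine $\mathfrak{X}$ started on some tape halts, the ex-machine with the states and instructions present at the halt is said to be what $\mathfrak{X}$ evolves to; repeating this (starting each new machine on a finitely bounded tape) gives an evolutionary path $\mathfrak{X}_0\to\mathfrak{X}_1\to\cdots$. Languages. Take $A=\{\texttt{\#},\texttt{0},\texttt{1},\texttt{N},\texttt{Y},\texttt{a}\}$. The input tape for $\texttt{a}^n$ ($n\ge0$) has $\texttt{a}$ on squares $1,\dots,n$, blanks elsewhere, head on square $0$, initial state $0$. The string $\texttt{a}^n$ is in the language of an ex-machine $\mathfrak{X}$ if $\mathfrak{X}$ started on this input halts with $\texttt{a}^n$ on squares $1..n$ and $\texttt{Y}$ on square $n+2$; it is not in the language if $\mathfrak{X}$ halts with $\texttt{N}$ on square $n+2$ instead. The machines. Name states $h=1$, $\mathtt{n}=2$, $\mathtt{y}=3$, $\mathtt{t}=4$,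 $\mathtt{v}=5$, $\mathtt{w}=6$, $\mathtt{x}=7$. Let $\mathcal{B}$ be the following 14 instructions: $(0,\#,8,\#,1)$, $(\mathtt{y},\#,h,\texttt{Y},0)$, $(\mathtt{n},\#,h,\texttt{N},0)$, quantum random $(\mathtt{x},\#,\mathtt{x},0)$ and $(\mathtt{x},\texttt{a},\mathtt{t},0)$, meta $(\mathtt{x},\texttt{0},\mathtt{v},\#,0,(|Q|-1,\#,\mathtt{n},\#,1))$, $(\mathtt{x},\texttt{1},\mathtt{w},\#,0,(|Q|-1,\#,\mathtt{y},\#,1))$, $(\mathtt{t},\texttt{0},\mathtt{w},\texttt{a},0,(|Q|-1,\#,\mathtt{n},\#,1))$, $(\mathtt{t},\texttt{1},\mathtt{w},\texttt{a},0,(|Q|-1,\#,\mathtt{y},\#,1))$, $(\mathtt{v},\#,\mathtt{n},\#,1,(|Q|-1,\texttt{a},|Q|,\texttt{a},1))$, $(\mathtt{w},\#,\mathtt{y},\#,1,(|Q|-1,\texttt{a},|Q|,\texttt{a},1))$, $(\mathtt{w},\texttt{a},|Q|,\texttt{a},1,(|Q|-1,\texttt{a},|Q|,\texttt{a},1))$, and simple meta instructions $(|Q|-1,\texttt{a},\mathtt{x},\texttt{a},0)$, $(|Q|-1,\#,\mathtt{x},\#,0)$. The ex-machine $\mathfrak{Q}(x)$ has states $\{0,\dots,8\}$ and instructions $\mathcal{B}\cup\{(8,\#,\mathtt{x},\#,0)\}$. For $a_0,\dots,a_m\in\{0,1\}$, $\mathfrak{Q}(a_0\dots a_m\,x)$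 has states $\{0,1,\dots,m+9\}$ and instructions $\mathcal{B}$ together with, for each $0\le i\le m$, $(i+8,\#,b_{i+8},\#,1)$ and $(i+8,\texttt{a},i+9,\texttt{a},1)$, where $b_{i+8}=\mathtt{y}$ if $a_i=1$ and $b_{i+8}=\mathtt{n}$ if $a_i=0$. -}

module Defs where

open import Data.Bool using (Bool; true; false; if_then_else_; _∧_; _∨_)
open import Data.Nat using (ℕ; zero; suc; _+_; _∸_; _≡ᵇ_; _<ᵇ_)
open import Data.Integer using (ℤ; +_; -[1+_]; +[1+_]; -1ℤ; 0ℤ; 1ℤ) renaming (_+_ to _+ℤ_)
import Data.Integer as ℤ
open import Data.List using (List; []; _∷_; _++_; [_]; filter; length)
open import Data.List.Membership.Propositional using (_∈_)
open import Data.Maybe using (Maybe; just; nothing)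
open import Data.Product using (_×_; _,_; ∃; ∃-syntax; Σ)
open import Function.Bundles using (_⇔_)
open import Relation.Nullary.Decidable using (⌊_⌋; ¬?)
open import Relation.Binary.PropositionalEquality using (_≡_)
open import Data.Nat using (_<_; _≤_)

-- Alphabet A = {#, 0, 1, N, Y, a}

data Sym : Set where
  blank s0 s1 sN sY sa : Sym

symEq : Sym → Sym → Bool
symEq blank blank = true
symEq s0 s0 = true
symEq s1 s1 = true
symEq sN sN = true
symEq sY sY = true
symEq sa sa = true
symEq _ _ = false

bitSym : Bool → Sym
bitSym false = s0
bitSym true  = s1

-- State entries: concrete numbers, or the symbols |Q| and |Q|-1

data SE : Set where
  lit     : ℕ → SE
  cardQ   : SE
  cardQm1 : SE

evalSE : ℕ → SE → ℕ
evalSE Q (lit n) = n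
evalSE Q cardQ   = Q
evalSE Q cardQm1 = Q ∸ 1

data Move : Set where
  L S R : Move

moveℤ : Move → ℤ
moveℤ L = -1ℤ
moveℤ S = 0ℤ
moveℤ R = 1ℤ

-- standard (q,a,r,α,y) and quantum random (q,a,r,y) instructions
data Basic : Set where
  std : SE → Sym → SE → Sym → Move → Basic
  qr  : SE → Sym → SE → Move → Basic

-- an instruction: standard, quantum random, or meta (q,a,r,α,y,J)
data Instr : Set where
  basic : Basic → Instr
  meta  : SE → Sym → SE → Sym → Move → Basic → Instr

firstB : Basic → SE
firstB (std q _ _ _ _) = q
firstB (qr q _ _ _)    = q

symB : Basic → Sym
symB (std _ a _ _ _) = a
symB (qr _ a _ _)    = a

first : Instr → SE
first (basic b) = firstB b
first (meta q _ _ _ _ _) = q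

symI : Instr → Sym
symI (basic b) = symB b
symI (meta _ a _ _ _ _) = a

instSE : ℕ → SE → SE
instSE Q e = lit (evalSE Q e)

instB : ℕ → Basic → Basic
instB Q (std q a r α y) = std (instSE Q q) a (instSE Q r) α y
instB Q (qr q a r y)    = qr (instSE Q q) a (instSE Q r) y

instI : ℕ → Instr → Instr
instI Q (basic b) = basic (instB Q b)
instI Q (meta q a r α y J) = meta (instSE Q q) a (instSE Q r) α y (instB Q J)

concreteKey : ℕ → Sym → Instr → Bool
concreteKey q a i with first i
... | lit p   = (p ≡ᵇ q) ∧ symEq (symI i) a
... | cardQ   = false
... | cardQm1 = false

-- is the instruction a simple meta instruction (first coordinate |Q|-1) for symbol a?
simpleMetaKey : Sym → Instr → Bool
simpleMetaKey a i with first i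
... | cardQm1 = symEq (symI i) a
... | _       = false

findB : (Instr → Bool) → List Instr → Maybe Instr
findB p [] = nothing
findB p (i ∷ is) = if p i then just i else findB p is

removeKey : ℕ → Sym → List Instr → List Instr
removeKey q a [] = []
removeKey q a (i ∷ is) = if concreteKey q a i then removeKey q a is else i ∷ removeKey q a is

-- replace the instruction with the same first two coordinates as J (already
-- instantiated, hence concrete), or add J
addOrReplace : Basic → List Instr → List Instr
addOrReplace J is with firstB J
... | lit q = removeKey q (symB J) is ++ [ basic J ]
... | _     = is ++ [ basic J ]

record ExMachine : Set where
  constructor exm
  field
    nQ     : ℕ            -- Q = {0, …, nQ-1}
    instrs : List Instr

record Config : Set where
  constructor cfg
  field
    state  : ℕ
    nQ     : ℕ
    tape   : ℤ → Sym
    head   : ℤ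
    instrs : List Instr
    ctr    : ℕ            -- number of quantum random bits consumed so far

haltState : ℕ
haltState = 1

write : (ℤ → Sym) → ℤ → Sym → (ℤ → Sym)
write T k α z = if ⌊ z ℤ.≟ k ⌋ then α else T z

grow : ℕ → ℕ → ℕ
grow Q r = if r ≡ᵇ Q then suc Q else Q

targetB : Basic → SE
targetB (std _ _ r _ _) = r
targetB (qr _ _ r _)    = r

grow2 : ℕ → ℕ → ℕ → ℕ
grow2 Q r r' = if (r ≡ᵇ Q) ∨ (r' ≡ᵇ Q) then suc Q else Q

exec : (ℕ → Bool) → Instr → Config → Config
exec bits i (cfg q Q T k I c) with instI Q i
... | basic (std _ _ r α y) =
  cfg (evalSE Q r) (grow Q (evalSE Q r)) (write T k α) (k +ℤ moveℤ y) I c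
... | basic (qr _ _ r y) =
  cfg (evalSE Q r) (grow Q (evalSE Q r)) (write T k (bitSym (bits c))) (k +ℤ moveℤ y) I (suc c)
... | meta _ _ r α y J =
  cfg (evalSE Q r) (grow2 Q (evalSE Q r) (evalSE Q (targetB J))) (write T k α) (k +ℤ moveℤ y) (addOrReplace J I) c

-- one computation step; a halted (state h) or stuck configuration is left unchanged
step : (ℕ → Bool) → Config → Config
step bits (cfg q Q T k I c) with q ≡ᵇ haltState
... | true  = cfg q Q T k I c
... | false with findB (concreteKey q (T k)) I
...   | just i  = exec bits i (cfg q Q T k I c)
...   | nothing with q ≡ᵇ (Q ∸ 1)
...     | false = cfg q Q T k I c
...     | true with findB (simpleMetaKey (T k)) I
...       | nothing = cfg q Q T k I c
...       | just i  = exec bits (instI Q i) (cfg q Q T k (I ++ [ instI Q i ]) c)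

iter : (ℕ → Bool) → ℕ → Config → Config
iter bits zero    c = c
iter bits (suc n) c = iter bits n (step bits c)

initCfg : ExMachine → (ℤ → Sym) → ℤ → Config
initCfg X T k = cfg 0 (ExMachine.nQ X) T k (ExMachine.instrs X) 0

HaltsAt : (ℕ → Bool) → ExMachine → (ℤ → Sym) → ℤ → ℕ → Set
HaltsAt bits X T k m = Config.state (iter bits m (initCfg X T k)) ≡ haltState

FinitelyBounded : (ℤ → Sym) → Set
FinitelyBounded T = ∃[ B ] (∀ z → B < ℤ.∣ z ∣ → T z ≡ blank)

Evolves : ExMachine → ExMachine → Set
Evolves X Y =
  ∃[ T ] FinitelyBounded T × ∃[ k ] ∃[ bits ] ∃[ m ]
    (HaltsAt bits X T k m
     × Config.nQ (iter bits m (initCfg X T k)) ≡ ExMachine.nQ Y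
     × (∀ i → (i ∈ Config.instrs (iter bits m (initCfg X T k))) ⇔ (i ∈ ExMachine.instrs Y)))

-- input tape for a^n: `a` on squares 1..n, blank elsewhere
inputTape : ℕ → ℤ → Sym
inputTape n (+[1+ i ]) = if i <ᵇ n then sa else blank
inputTape n _ = blank

HaltsWith : Sym → ExMachine → ℕ → Set
HaltsWith s X n = ∀ (bits : ℕ → Bool) → ∃[ m ]
  (HaltsAt bits X (inputTape n) 0ℤ m
   × (∀ i → 1 ≤ i → i ≤ n → Config.tape (iter bits m (initCfg X (inputTape n) 0ℤ)) (+ i) ≡ sa)
   × Config.tape (iter bits m (initCfg X (inputTape n) 0ℤ)) (+ (n + 2)) ≡ s)

InLanguage : ExMachine → ℕ → Set
InLanguage = HaltsWith sY

NotInLanguage : ExMachine → ℕ → Set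
NotInLanguage = HaltsWith sN

hS nS yS tS vS wS xS : SE
hS = lit 1
nS = lit 2
yS = lit 3
tS = lit 4
vS = lit 5
wS = lit 6
xS = lit 7

𝓑 : List Instr
𝓑 =
  basic (std (lit 0) blank (lit 8) blank R) ∷
  basic (std yS blank hS sY S) ∷
  basic (std nS blank hS sN S) ∷
  basic (qr xS blank xS S) ∷
  basic (qr xS sa tS S) ∷
  meta xS s0 vS blank S (std cardQm1 blank nS blank R) ∷
  meta xS s1 wS blank S (std cardQm1 blank yS blank R) ∷
  meta tS s0 wS sa S (std cardQm1 blank nS blank R) ∷
  meta tS s1 wS sa S (std cardQm1 blank yS blank R) ∷
  meta vS blank nS blank R (std cardQm1 sa cardQ sa R) ∷
  meta wS blank yS blank R (std cardQm1 sa cardQ sa R) ∷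
  meta wS sa cardQ sa R (std cardQm1 sa cardQ sa R) ∷
  basic (std cardQm1 sa xS sa S) ∷
  basic (std cardQm1 blank xS blank S) ∷
  []

bState : Bool → ℕ
bState true  = 3
bState false = 2

extra : ℕ → List Bool → List Instr
extra i [] = []
extra i (b ∷ bs) =
  basic (std (lit (i + 8)) blank (lit (bState b)) blank R) ∷
  basic (std (lit (i + 8)) sa (lit (i + 9)) sa R) ∷
  extra (suc i) bs

-- 𝔔(a₀ … a_m x) for the list [a₀ , … , a_m] (true = 1); 𝔔 [] = 𝔔(x)
𝔔 : List Bool → ExMachine
𝔔 [] = exm 9 (𝓑 ++ [ basic (std (lit 8) blank xS blank S) ])
𝔔 (b ∷ bs) = exm (9 + length (b ∷ bs)) (𝓑 ++ extra 0 (b ∷ bs))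

-- The program of 𝔔(a₀ … a_m x) is the block 𝓑 plus, for every stored bit aᵢ,
-- a scan instruction (i+8, a, i+9, a, 1) and an answer instruction
-- (i+8, #, bᵢ, #, 1).  On input aⁿ the machine walks along the a's through
-- the states 8, …, n+8 and at the first blank:
--   * if n ≤ m, the stored answer sends it to y or n, which writes Y or N on
--     square n+2 and halts (the decision run);
--   * if n = m+1, the state n+8 = |Q|-1 has no instruction for #, so the simple
--     meta instruction sends it to x, which draws a bit b, installs the answer
--     for b and the next scan instruction, adds the state |Q| and halts as
--     𝔔(a₀ … a_m b x) (the learning run).
module Submission where

open import Defs
open import Data.Bool using (Bool; true; false; T)
open import Data.Bool.Properties using (T-≡; ∨-zeroʳ)
open import Data.Nat using (ℕ; zero; suc; _+_; _∸_; _≤_; _<_; _≡ᵇ_; _<ᵇ_; z≤n; s≤s)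
open import Data.Nat.Properties
  using (≡ᵇ⇒≡; ≡⇒≡ᵇ; <ᵇ⇒<; <⇒<ᵇ; ≤-reflexive; ≤-refl; ≤-trans; <⇒≢; <⇒≱; <⇒≤;
         m<n⇒m<1+n; 1+n≢n; n≤1+n; suc-injective;
         +-suc; +-comm; +-identityʳ; m≤m+n; m≤n+m; +-monoˡ-≤; +-monoʳ-<)
open import Data.Integer using (ℤ; +_; 0ℤ; 1ℤ) renaming (_+_ to _+ℤ_)
import Data.Integer as ℤ
import Data.Integer.Properties as ℤP
open import Data.List using (List; []; _∷_; _++_; [_]; _∷ʳ_; length; applyUpTo)
open import Data.List.Properties using (++-assoc; ++-identityʳ; length-++; length-applyUpTo; applyUpTo-∷ʳ)
open import Data.List.Membership.Propositional using (_∈_)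
open import Data.Maybe using (just; nothing)
open import Data.Product using (_×_; _,_; ∃-syntax)
open import Data.Empty using (⊥-elim)
open import Function using (_∘_)
open import Function.Bundles using (_⇔_; mk⇔; Equivalence)
open import Relation.Nullary using (¬_; yes; no)
open import Relation.Binary.PropositionalEquality hiding ([_])
open ≡-Reasoning

¬T⇒≡false : ∀ {b} → ¬ T b → b ≡ false
¬T⇒≡false {false} _  = refl
¬T⇒≡false {true}  ¬t = ⊥-elim (¬t _)

≡ᵇ-refl : ∀ m → (m ≡ᵇ m) ≡ true
≡ᵇ-refl m = Equivalence.to T-≡ (≡⇒≡ᵇ m m refl)

≢⇒≡ᵇ-false : ∀ {m n} → m ≢ n → (m ≡ᵇ n) ≡ false
≢⇒≡ᵇ-false {m} {n} m≢n = ¬T⇒≡false (m≢n ∘ ≡ᵇ⇒≡ m n)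

<⇒≡ᵇ-false : ∀ {m n} → m < n → (m ≡ᵇ n) ≡ false
<⇒≡ᵇ-false = ≢⇒≡ᵇ-false ∘ <⇒≢

not-halting : ∀ {q} → 8 ≤ q → (q ≡ᵇ haltState) ≡ false
not-halting (s≤s (s≤s _)) = refl

write-same : ∀ T k α → write T k α k ≡ α
write-same T k α with k ℤ.≟ k
... | yes _  = refl
... | no k≢k = ⊥-elim (k≢k refl)

write-other : ∀ T k α {z} → z ≢ k → write T k α z ≡ T z
write-other T k α {z} z≢k with z ℤ.≟ k
... | yes z≡k = ⊥-elim (z≢k z≡k)
... | no _    = refl

write-unchanged : ∀ T k α → T k ≡ α → write T k α ≗ T
write-unchanged T k α Tk≡α z with z ℤ.≟ k
... | yes refl = sym Tk≡α
... | no _     = refl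

+suc≢ : ∀ {i j} → i ≢ j → + suc i ≢ + suc j
+suc≢ i≢j = i≢j ∘ suc-injective ∘ ℤP.+-injective

step-right : ∀ n → + suc n +ℤ 1ℤ ≡ + suc (suc n)
step-right n = cong +_ (+-comm (suc n) 1)

input-a : ∀ {n i} → i < n → inputTape n (+ suc i) ≡ sa
input-a {n} {i} i<n rewrite Equivalence.to T-≡ (<⇒<ᵇ i<n) = refl

input-blank : ∀ {n i} → n ≤ i → inputTape n (+ suc i) ≡ blank
input-blank {n} {i} n≤i
  rewrite ¬T⇒≡false {i <ᵇ n} (λ t → <⇒≱ (<ᵇ⇒< i n t) n≤i) = refl

inputTape-bounded : ∀ n → FinitelyBounded (inputTape n)
inputTape-bounded n = n , bounded
  where
  bounded : ∀ z → n < ℤ.∣ z ∣ → inputTape n z ≡ blank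
  bounded (+ zero)     _         = refl
  bounded (+ suc i)    (s≤s n≤i) = input-blank n≤i
  bounded (ℤ.negsuc i) _         = refl

cfg-cong : ∀ {q q′ Q Q′ T k k′ I I′ c} →
  q ≡ q′ → Q ≡ Q′ → k ≡ k′ → I ≡ I′ → cfg q Q T k I c ≡ cfg q′ Q′ T k′ I′ c
cfg-cong refl refl refl refl = refl

step-std : ∀ {bits q Q T k I c a q′ a′ r α y} →
  (q ≡ᵇ haltState) ≡ false → T k ≡ a →
  findB (concreteKey q a) I ≡ just (basic (std (lit q′) a′ (lit r) α y)) →
  step bits (cfg q Q T k I c) ≡ cfg r (grow Q r) (write T k α) (k +ℤ moveℤ y) I c
step-std running scanned found rewrite running | scanned | found = refl

step-qr : ∀ {bits q Q T k I c a q′ a′ r y} →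
  (q ≡ᵇ haltState) ≡ false → T k ≡ a →
  findB (concreteKey q a) I ≡ just (basic (qr (lit q′) a′ (lit r) y)) →
  step bits (cfg q Q T k I c)
    ≡ cfg r (grow Q r) (write T k (bitSym (bits c))) (k +ℤ moveℤ y) I (suc c)
step-qr running scanned found rewrite running | scanned | found = refl

step-meta : ∀ {bits q Q T k I c a q′ a′ r α y J} →
  (q ≡ᵇ haltState) ≡ false → T k ≡ a →
  findB (concreteKey q a) I ≡ just (meta (lit q′) a′ (lit r) α y J) →
  step bits (cfg q Q T k I c)
    ≡ cfg r (grow2 Q r (evalSE Q (targetB (instB Q J)))) (write T k α) (k +ℤ moveℤ y)
          (addOrReplace (instB Q J) I) c
step-meta running scanned found rewrite running | scanned | found = refl

step-simpleMeta : ∀ {bits q Q T k I c a i} →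
  (q ≡ᵇ haltState) ≡ false → T k ≡ a → findB (concreteKey q a) I ≡ nothing →
  (q ≡ᵇ (Q ∸ 1)) ≡ true → findB (simpleMetaKey a) I ≡ just i →
  step bits (cfg q Q T k I c) ≡ exec bits (instI Q i) (cfg q Q T k (I ++ [ instI Q i ]) c)
step-simpleMeta running scanned none last found
  rewrite running | scanned | none | last | scanned | found = refl

grow-existing : ∀ {r Q} → r < Q → grow Q r ≡ Q
grow-existing r<Q rewrite <⇒≡ᵇ-false r<Q = refl

iter-+ : ∀ bits m n c → iter bits (m + n) c ≡ iter bits n (iter bits m c)
iter-+ bits zero    n c = refl
iter-+ bits (suc m) n c = iter-+ bits m n (step bits c)

iter-halted : ∀ bits m c → Config.state c ≡ haltState → iter bits m c ≡ c
iter-halted bits zero    c                       _    = refl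
iter-halted bits (suc m) c@(cfg .1 Q T k I ctr) refl = iter-halted bits m c refl

halted-unique : ∀ {bits c} m m′ →
  Config.state (iter bits m c) ≡ haltState → Config.state (iter bits m′ c) ≡ haltState →
  iter bits m c ≡ iter bits m′ c
halted-unique {bits} {c} m m′ halt halt′ = begin
  iter bits m c                     ≡⟨ iter-halted bits m′ _ halt ⟨
  iter bits m′ (iter bits m c)      ≡⟨ iter-+ bits m m′ c ⟨
  iter bits (m + m′) c              ≡⟨ cong (λ j → iter bits j c) (+-comm m m′) ⟩
  iter bits (m′ + m) c              ≡⟨ iter-+ bits m′ m c ⟩
  iter bits m (iter bits m′ c)      ≡⟨ iter-halted bits m _ halt′ ⟩
  iter bits m′ c                    ∎

haltsWith-unique : ∀ {s s′ X n} → HaltsWith s X n → HaltsWith s′ X n → s ≡ s′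
haltsWith-unique {n = n} h h′ with h (λ _ → false) | h′ (λ _ → false)
... | m , halt , _ , answer | m′ , halt′ , _ , answer′ =
  trans (sym answer)
        (trans (cong (λ c → Config.tape c (+ (n + 2))) (halted-unique m m′ halt halt′)) answer′)

evolves-via : ∀ {X Y T} → FinitelyBounded T → ∀ k bits m →
  Config.state (iter bits m (initCfg X T k)) ≡ haltState →
  Config.nQ (iter bits m (initCfg X T k)) ≡ ExMachine.nQ Y →
  Config.instrs (iter bits m (initCfg X T k)) ≡ ExMachine.instrs Y →
  Evolves X Y
evolves-via {T = T} bounded k bits m halts states instrs =
  T , bounded , k , bits , m , halts , states ,
  λ i → mk⇔ (subst (i ∈_) instrs) (subst (i ∈_) (sym instrs))

-- A trace of m single steps leading from c to c′.  Runs of symbolic length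
-- are assembled from the one-step lemmas as traces, so that the type checker
-- never has to evaluate them step by step.
infixr 5 _▸_
data Run (bits : ℕ → Bool) : ℕ → Config → Config → Set where
  stop : ∀ {c} → Run bits 0 c c
  _▸_  : ∀ {m c c′ c″} → step bits c ≡ c′ → Run bits m c′ c″ → Run bits (suc m) c c″

run⇒iter : ∀ {bits m c c′} → Run bits m c c′ → iter bits m c ≡ c′
run⇒iter stop           = refl
run⇒iter (refl ▸ trace) = run⇒iter trace

infixr 5 _▸▸_
_▸▸_ : ∀ {bits m m′ c c′ c″} → Run bits m c c′ → Run bits m′ c′ c″ → Run bits (m + m′) c c″
stop           ▸▸ trace′ = trace′
(first ▸ rest) ▸▸ trace′ = first ▸ (rest ▸▸ trace′)

_▸ᵉ_ : ∀ {bits m c c′ c″} → Run bits m c c′ → step bits c′ ≡ c″ → Run bits (suc m) c c″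
stop           ▸ᵉ last = last ▸ stop
(first ▸ rest) ▸ᵉ last = first ▸ (rest ▸ᵉ last)

program : List Bool → List Instr
program cs = 𝓑 ++ extra 0 cs

scanInstr : ℕ → Instr
scanInstr i = basic (std (lit (i + 8)) sa (lit (i + 9)) sa R)

answerInstr : ℕ → Bool → Instr
answerInstr i b = basic (std (lit (i + 8)) blank (lit (bState b)) blank R)

-- 𝓑 only has keys with states below 8 (or the symbolic |Q|-1).
find-𝓑-skip : ∀ {q} s X → 8 ≤ q → findB (concreteKey q s) (𝓑 ++ X) ≡ findB (concreteKey q s) X
find-𝓑-skip s X (s≤s (s≤s (s≤s (s≤s (s≤s (s≤s (s≤s (s≤s _)))))))) = refl

remove-𝓑 : ∀ {q} s → 8 ≤ q → removeKey q s 𝓑 ≡ 𝓑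
remove-𝓑 s (s≤s (s≤s (s≤s (s≤s (s≤s (s≤s (s≤s (s≤s _)))))))) = refl

removeKey-++ : ∀ q s xs ys → removeKey q s (xs ++ ys) ≡ removeKey q s xs ++ removeKey q s ys
removeKey-++ q s []       ys = refl
removeKey-++ q s (x ∷ xs) ys with concreteKey q s x
... | true  = removeKey-++ q s xs ys
... | false = cong (x ∷_) (removeKey-++ q s xs ys)

find-extra-skip : ∀ {q} s j b bs → j + 8 ≢ q →
  findB (concreteKey q s) (extra j (b ∷ bs)) ≡ findB (concreteKey q s) (extra (suc j) bs)
find-extra-skip s j b bs ne rewrite ≢⇒≡ᵇ-false ne = refl

remove-extra-skip : ∀ {q} s j b bs → j + 8 ≢ q →
  removeKey q s (extra j (b ∷ bs)) ≡ answerInstr j b ∷ scanInstr j ∷ removeKey q s (extra (suc j) bs)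
remove-extra-skip s j b bs ne rewrite ≢⇒≡ᵇ-false ne = refl

earlier-key : ∀ j d → j + 8 ≢ suc (j + d) + 8
earlier-key j d = <⇒≢ (s≤s (+-monoˡ-≤ 8 (m≤m+n j d)))

find-scan : ∀ cs j d → d < length cs →
  findB (concreteKey (j + d + 8) sa) (extra j cs) ≡ just (scanInstr (j + d))
find-scan (b ∷ cs) j zero    _ rewrite +-identityʳ j | ≡ᵇ-refl (j + 8) = refl
find-scan (b ∷ cs) j (suc d) (s≤s d<L) rewrite +-suc j d =
  trans (find-extra-skip sa j b cs (earlier-key j d)) (find-scan cs (suc j) d d<L)

find-answer : ∀ f m j d → d < m →
  findB (concreteKey (j + d + 8) blank) (extra j (applyUpTo f m)) ≡ just (answerInstr (j + d) (f d))
find-answer f (suc m) j zero    _ rewrite +-identityʳ j | ≡ᵇ-refl (j + 8) = refl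
find-answer f (suc m) j (suc d) (s≤s d<m) rewrite +-suc j d =
  trans (find-extra-skip blank j (f 0) (applyUpTo (f ∘ suc) m) (earlier-key j d))
        (find-answer (f ∘ suc) m (suc j) d d<m)

beyond-key : ∀ {q} j n → j + suc n + 8 ≤ q → j + 8 ≢ q × suc j + n + 8 ≤ q
beyond-key j n le rewrite +-suc j n =
  <⇒≢ (≤-trans (s≤s (+-monoˡ-≤ 8 (m≤m+n j n))) le) , le

find-beyond : ∀ {q} s cs j → j + length cs + 8 ≤ q → findB (concreteKey q s) (extra j cs) ≡ nothing
find-beyond s []       j _  = refl
find-beyond s (b ∷ cs) j le with beyond-key j (length cs) le
... | ne , le′ = trans (find-extra-skip s j b cs ne) (find-beyond s cs (suc j) le′)

remove-beyond : ∀ {q} s cs j → j + length cs + 8 ≤ q → removeKey q s (extra j cs) ≡ extra j cs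
remove-beyond s []       j _  = refl
remove-beyond s (b ∷ cs) j le with beyond-key j (length cs) le
... | ne , le′ = trans (remove-extra-skip s j b cs ne) (cong (λ I → _ ∷ _ ∷ I) (remove-beyond s cs (suc j) le′))

remove-program : ∀ {q} s cs → length cs + 8 ≤ q → removeKey q s (program cs) ≡ program cs
remove-program {q} s cs le = begin
  removeKey q s (𝓑 ++ extra 0 cs)               ≡⟨ removeKey-++ q s 𝓑 (extra 0 cs) ⟩
  removeKey q s 𝓑 ++ removeKey q s (extra 0 cs) ≡⟨ cong₂ _++_ (remove-𝓑 s 8≤q) (remove-beyond s cs 0 le) ⟩
  𝓑 ++ extra 0 cs                               ∎
  where
  8≤q : 8 ≤ q
  8≤q = ≤-trans (m≤n+m 8 (length cs)) le

scan-step : ∀ {bits cs c T} n → n < length cs → T (+ suc n) ≡ sa →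
  step bits (cfg (n + 8) (9 + length cs) T (+ suc n) (program cs) c)
    ≡ cfg (suc n + 8) (9 + length cs) (write T (+ suc n) sa) (+ suc (suc n)) (program cs) c
scan-step {cs = cs} n n<L reads-a =
  trans (step-std {q = n + 8} (not-halting 8≤n+8) reads-a
                  (trans (find-𝓑-skip sa (extra 0 cs) 8≤n+8) (find-scan cs 0 n n<L)))
        (cfg-cong (+-suc n 8) (grow-existing n+9<Q) (step-right n) refl)
  where
  8≤n+8 : 8 ≤ n + 8
  8≤n+8 = m≤n+m 8 n
  n+9<Q : n + 9 < 9 + length cs
  n+9<Q = subst (_< 9 + length cs) (+-comm 9 n) (+-monoʳ-< 9 n<L)

scan-phase : ∀ bits cs c T n → n ≤ length cs → (∀ e → e < n → T (+ suc e) ≡ sa) →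
  ∃[ T′ ] (T′ ≗ T ×
    Run bits n (cfg 8 (9 + length cs) T 1ℤ (program cs) c)
               (cfg (n + 8) (9 + length cs) T′ (+ suc n) (program cs) c))
scan-phase bits cs c T zero    _   _  = T , (λ _ → refl) , stop
scan-phase bits cs c T (suc n) n<L as
  with scan-phase bits cs c T n (<⇒≤ n<L) (λ e e<n → as e (m<n⇒m<1+n e<n))
... | T′ , T′≗T , trace =
  write T′ (+ suc n) sa , unchanged , trace ▸ᵉ scan-step n n<L reads-a
  where
  reads-a : T′ (+ suc n) ≡ sa
  reads-a = trans (T′≗T _) (as n ≤-refl)
  unchanged : write T′ (+ suc n) sa ≗ T
  unchanged z = trans (write-unchanged T′ (+ suc n) sa reads-a z) (T′≗T z)

scan-input : ∀ bits cs n → n ≤ length cs →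
  ∃[ T′ ] (T′ ≗ inputTape n ×
    Run bits (suc n) (cfg 0 (9 + length cs) (inputTape n) 0ℤ (program cs) 0)
                     (cfg (n + 8) (9 + length cs) T′ (+ suc n) (program cs) 0))
scan-input bits cs n n≤L =
  let T′ , T′≗T₀ , trace = scan-phase bits cs 0 T₀ n n≤L (λ e e<n → trans (T₀≗ _) (input-a e<n))
  in T′ , (λ z → trans (T′≗T₀ z) (T₀≗ z)) , refl ▸ trace
  where
  T₀ : ℤ → Sym
  T₀ = write (inputTape n) 0ℤ blank
  T₀≗ : T₀ ≗ inputTape n
  T₀≗ = write-unchanged (inputTape n) 0ℤ blank refl

verdict : Bool → Sym
verdict true  = sY
verdict false = sN

verdict-injective : ∀ {β γ} → verdict β ≡ verdict γ → β ≡ γ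
verdict-injective {true}  {true}  _ = refl
verdict-injective {false} {false} _ = refl

output-state-exists : ∀ β M → bState β < 9 + M
output-state-exists true  M = s≤s (s≤s (s≤s (s≤s z≤n)))
output-state-exists false M = s≤s (s≤s (s≤s z≤n))

answer-step : ∀ {bits c T} f m n → n < m → T (+ suc n) ≡ blank →
  step bits (cfg (n + 8) (9 + length (applyUpTo f m)) T (+ suc n) (program (applyUpTo f m)) c)
    ≡ cfg (bState (f n)) (9 + length (applyUpTo f m)) (write T (+ suc n) blank) (+ suc (suc n))
          (program (applyUpTo f m)) c
answer-step f m n n<m reads-blank =
  trans (step-std {q = n + 8} (not-halting 8≤n+8) reads-blank
                  (trans (find-𝓑-skip blank (extra 0 (applyUpTo f m)) 8≤n+8) (find-answer f m 0 n n<m)))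
        (cfg-cong refl (grow-existing (output-state-exists (f n) _)) (step-right n) refl)
  where
  8≤n+8 : 8 ≤ n + 8
  8≤n+8 = m≤n+m 8 n

halt-step : ∀ β {bits M k X c} T → T k ≡ blank →
  step bits (cfg (bState β) (9 + M) T k (𝓑 ++ X) c)
    ≡ cfg haltState (9 + M) (write T k (verdict β)) k (𝓑 ++ X) c
halt-step true  T reads-blank =
  trans (step-std {q = 3} refl reads-blank refl) (cfg-cong refl refl (ℤP.+-identityʳ _) refl)
halt-step false T reads-blank =
  trans (step-std {q = 2} refl reads-blank refl) (cfg-cong refl refl (ℤP.+-identityʳ _) refl)

decides : ∀ f k n → n ≤ k → HaltsWith (verdict (f n)) (𝔔 (applyUpTo f (suc k))) n
decides f k n n≤k bits
  with scan-input bits (applyUpTo f (suc k)) n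
         (subst (n ≤_) (sym (length-applyUpTo f (suc k))) (≤-trans n≤k (n≤1+n k)))
... | T₁ , T₁≗ , scan =
  suc (n + 2) , cong Config.state run ,
  (λ i 1≤i i≤n → trans (final-tape (+ i)) (keeps-input i 1≤i i≤n)) ,
  trans (final-tape (+ (n + 2))) writes-verdict
  where
  cs : List Bool
  cs = applyUpTo f (suc k)
  T₂ T₃ : ℤ → Sym
  T₂ = write T₁ (+ suc n) blank
  T₃ = write T₂ (+ suc (suc n)) (verdict (f n))
  T₂-blank : T₂ (+ suc (suc n)) ≡ blank
  T₂-blank = trans (write-other T₁ _ _ (+suc≢ 1+n≢n)) (trans (T₁≗ _) (input-blank (n≤1+n n)))
  run : iter bits (suc (n + 2)) (initCfg (𝔔 cs) (inputTape n) 0ℤ)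
        ≡ cfg haltState (9 + length cs) T₃ (+ suc (suc n)) (program cs) 0
  run = run⇒iter (scan
                    ▸▸ answer-step f (suc k) n (s≤s n≤k) (trans (T₁≗ _) (input-blank {n} ≤-refl))
                    ▸ halt-step (f n) T₂ T₂-blank
                    ▸ stop)
  final-tape : ∀ z → Config.tape (iter bits (suc (n + 2)) (initCfg (𝔔 cs) (inputTape n) 0ℤ)) z ≡ T₃ z
  final-tape z = cong (λ c → Config.tape c z) run
  keeps-input : ∀ i → 1 ≤ i → i ≤ n → T₃ (+ i) ≡ sa
  keeps-input (suc j) _ j<n =
    trans (write-other T₂ _ _ (+suc≢ (<⇒≢ (m<n⇒m<1+n j<n))))
          (trans (write-other T₁ _ _ (+suc≢ (<⇒≢ j<n))) (trans (T₁≗ _) (input-a j<n)))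
  writes-verdict : T₃ (+ (n + 2)) ≡ verdict (f n)
  writes-verdict =
    trans (cong (λ m → T₃ (+ m)) (+-comm n 2)) (write-same T₂ (+ suc (suc n)) (verdict (f n)))

language : ∀ f k n → n ≤ k → ∀ β →
  HaltsWith (verdict β) (𝔔 (applyUpTo f (suc k))) n ⇔ f n ≡ β
language f k n n≤k β =
  mk⇔ (λ halts → verdict-injective (haltsWith-unique (decides f k n n≤k) halts))
      (λ { refl → decides f k n n≤k })

-- The learning run happens past the stored bits, in the last state
-- |Q|-1 = L+8 on the blank after aᴸ (L = length cs).  The simple meta
-- instruction (|Q|-1, #, x, #, 0) installs the instruction toDraw L.
toDraw : ℕ → Instr
toDraw m = basic (std (lit (8 + m)) blank xS blank S)

-- The states v and w remembering the drawn bit.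
pendingState : Bool → ℕ
pendingState false = 5
pendingState true  = 6

grow2-new : ∀ Q r → grow2 Q r Q ≡ suc Q
grow2-new Q r rewrite ≡ᵇ-refl Q | ∨-zeroʳ (r ≡ᵇ Q) = refl

extend-step : ∀ {bits c k} cs T → T k ≡ blank →
  step bits (cfg (length cs + 8) (9 + length cs) T k (program cs) c)
    ≡ cfg 7 (9 + length cs) (write T k blank) k (program cs ++ [ toDraw (length cs) ]) c
extend-step cs T reads-blank =
  trans (step-simpleMeta {q = length cs + 8} (not-halting 8≤L+8) reads-blank
           (trans (find-𝓑-skip blank (extra 0 cs) 8≤L+8) (find-beyond blank cs 0 ≤-refl))
           (trans (cong (length cs + 8 ≡ᵇ_) (+-comm 8 (length cs))) (≡ᵇ-refl (length cs + 8)))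
           refl)
        (cfg-cong refl refl (ℤP.+-identityʳ _) refl)
  where
  8≤L+8 : 8 ≤ length cs + 8
  8≤L+8 = m≤n+m 8 (length cs)

draw-step : ∀ {bits M k X c} T → T k ≡ blank →
  step bits (cfg 7 (9 + M) T k (𝓑 ++ X) c)
    ≡ cfg 7 (9 + M) (write T k (bitSym (bits c))) k (𝓑 ++ X) (suc c)
draw-step T reads-blank =
  trans (step-qr {q = 7} refl reads-blank refl) (cfg-cong refl refl (ℤP.+-identityʳ _) refl)

choose-step : ∀ b {bits M k X c} T → T k ≡ bitSym b →
  step bits (cfg 7 (9 + M) T k (𝓑 ++ X) c)
    ≡ cfg (pendingState b) (9 + M) (write T k blank) k
          (addOrReplace (std (lit (8 + M)) blank (lit (bState b)) blank R) (𝓑 ++ X)) c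
choose-step false {M = M} {X = X} T reads-bit =
  trans (step-meta {q = 7} {Q = 9 + M} {I = 𝓑 ++ X} refl reads-bit refl)
        (cfg-cong refl refl (ℤP.+-identityʳ _) refl)
choose-step true  {M = M} {X = X} T reads-bit =
  trans (step-meta {q = 7} {Q = 9 + M} {I = 𝓑 ++ X} refl reads-bit refl)
        (cfg-cong refl refl (ℤP.+-identityʳ _) refl)

commit-step : ∀ b {bits M k X c} T → T k ≡ blank →
  step bits (cfg (pendingState b) (9 + M) T k (𝓑 ++ X) c)
    ≡ cfg (bState b) (suc (9 + M)) (write T k blank) (k +ℤ 1ℤ)
          (addOrReplace (std (lit (8 + M)) sa (lit (9 + M)) sa R) (𝓑 ++ X)) c
commit-step false {M = M} {X = X} T reads-blank =
  trans (step-meta {q = 5} {Q = 9 + M} {I = 𝓑 ++ X} refl reads-blank refl)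
        (cfg-cong refl (grow2-new (9 + M) 2) refl refl)
commit-step true  {M = M} {X = X} T reads-blank =
  trans (step-meta {q = 6} {Q = 9 + M} {I = 𝓑 ++ X} refl reads-blank refl)
        (cfg-cong refl (grow2-new (9 + M) 3) refl refl)

extra-++ : ∀ j xs ys → extra j (xs ++ ys) ≡ extra j xs ++ extra (j + length xs) ys
extra-++ j []       ys rewrite +-identityʳ j = refl
extra-++ j (x ∷ xs) ys rewrite +-suc j (length xs) = cong (λ I → _ ∷ _ ∷ I) (extra-++ (suc j) xs ys)

program-∷ʳ : ∀ cs b →
  program (cs ∷ʳ b) ≡ (program cs ++ [ answerInstr (length cs) b ]) ++ [ scanInstr (length cs) ]
program-∷ʳ cs b = begin
  𝓑 ++ extra 0 (cs ++ [ b ])                      ≡⟨ cong (𝓑 ++_) (extra-++ 0 cs [ b ]) ⟩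
  𝓑 ++ (extra 0 cs ++ extra (length cs) [ b ])    ≡⟨ ++-assoc 𝓑 (extra 0 cs) _ ⟨
  program cs ++ extra (length cs) [ b ]           ≡⟨ ++-assoc (program cs) _ _ ⟨
  (program cs ++ [ answerInstr (length cs) b ]) ++ [ scanInstr (length cs) ] ∎

-- The instructions installed during the learning run, which replace the
-- temporary instruction toDraw, give exactly the program with b stored.
learned-program : ∀ cs b →
  addOrReplace (std (lit (8 + length cs)) sa (lit (9 + length cs)) sa R)
    (addOrReplace (std (lit (8 + length cs)) blank (lit (bState b)) blank R)
      (program cs ++ [ toDraw (length cs) ]))
  ≡ program (cs ∷ʳ b)
learned-program cs b = begin
  removeKey K sa (removeKey K blank (P ++ [ toDraw n ]) ++ [ newAnswer ]) ++ [ newScan ]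
    ≡⟨ cong (λ I → removeKey K sa (I ++ [ newAnswer ]) ++ [ newScan ]) forget-draw ⟩
  removeKey K sa (P ++ [ newAnswer ]) ++ [ newScan ]
    ≡⟨ cong (_++ [ newScan ]) keep-answer ⟩
  (P ++ [ newAnswer ]) ++ [ newScan ]
    ≡⟨ cong₂ (λ p p′ → (P ++ [ basic (std (lit p) blank (lit (bState b)) blank R) ])
                         ++ [ basic (std (lit p) sa (lit p′) sa R) ])
             (+-comm 8 n) (+-comm 9 n) ⟩
  (P ++ [ answerInstr n b ]) ++ [ scanInstr n ]
    ≡⟨ program-∷ʳ cs b ⟨
  program (cs ∷ʳ b) ∎
  where
  n K : ℕ
  n = length cs
  K = 8 + n
  P : List Instr
  P = program cs
  newAnswer newScan : Instr
  newAnswer = basic (std (lit K) blank (lit (bState b)) blank R)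
  newScan = basic (std (lit K) sa (lit (9 + n)) sa R)
  P-kept : ∀ s → removeKey K s P ≡ P
  P-kept s = remove-program s cs (≤-reflexive (+-comm n 8))
  draw-removed : removeKey K blank [ toDraw n ] ≡ []
  draw-removed rewrite ≡ᵇ-refl K = refl
  answer-kept : removeKey K sa [ newAnswer ] ≡ [ newAnswer ]
  answer-kept rewrite ≡ᵇ-refl K = refl
  forget-draw : removeKey K blank (P ++ [ toDraw n ]) ≡ P
  forget-draw = begin
    removeKey K blank (P ++ [ toDraw n ])                    ≡⟨ removeKey-++ K blank P _ ⟩
    removeKey K blank P ++ removeKey K blank [ toDraw n ]    ≡⟨ cong₂ _++_ (P-kept blank) draw-removed ⟩
    P ++ []                                                  ≡⟨ ++-identityʳ P ⟩
    P                                                        ∎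
  keep-answer : removeKey K sa (P ++ [ newAnswer ]) ≡ P ++ [ newAnswer ]
  keep-answer = trans (removeKey-++ K sa P _) (cong₂ _++_ (P-kept sa) answer-kept)

length-∷ʳ : ∀ cs (b : Bool) → length (cs ∷ʳ b) ≡ suc (length cs)
length-∷ʳ cs b = trans (length-++ cs) (+-comm (length cs) 1)

learn-tail : ∀ bits cs b {T c} → bits c ≡ b →
  T (+ suc (length cs)) ≡ blank → T (+ suc (suc (length cs))) ≡ blank →
  ∃[ T′ ] Run bits 5 (cfg (length cs + 8) (9 + length cs) T (+ suc (length cs)) (program cs) c)
                     (cfg haltState (9 + length (cs ∷ʳ b)) T′ (+ suc (suc (length cs)))
                          (program (cs ∷ʳ b)) (suc c))
learn-tail bits cs b {T} {c} drawn here-blank next-blank =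
  T₅ ,
  extend-step cs T here-blank
  ▸ draw-step T₁ (write-same T here blank)
  ▸ choose-step b T₂ (trans (write-same T₁ here _) (cong bitSym drawn))
  ▸ trans (commit-step b T₃ (write-same T₂ here blank))
          (cfg-cong refl (cong (λ m → 9 + m) (sym (length-∷ʳ cs b))) (step-right n)
                    (learned-program cs b))
  ▸ halt-step b T₄ T₄-next
  ▸ stop
  where
  n : ℕ
  n = length cs
  here next : ℤ
  here = + suc n
  next = + suc (suc n)
  T₁ T₂ T₃ T₄ T₅ : ℤ → Sym
  T₁ = write T here blank
  T₂ = write T₁ here (bitSym (bits c))
  T₃ = write T₂ here blank
  T₄ = write T₃ here blank
  T₅ = write T₄ next (verdict b)
  next≢here : next ≢ here
  next≢here = +suc≢ 1+n≢n
  T₄-next : T₄ next ≡ blank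
  T₄-next = begin
    T₄ next ≡⟨ write-other T₃ here blank next≢here ⟩
    T₃ next ≡⟨ write-other T₂ here blank next≢here ⟩
    T₂ next ≡⟨ write-other T₁ here (bitSym (bits c)) next≢here ⟩
    T₁ next ≡⟨ write-other T here blank next≢here ⟩
    T next  ≡⟨ next-blank ⟩
    blank   ∎

learning-run : ∀ bits cs b → bits 0 ≡ b → ∃[ T′ ]
  iter bits (suc (length cs + 5)) (cfg 0 (9 + length cs) (inputTape (length cs)) 0ℤ (program cs) 0)
    ≡ cfg haltState (9 + length (cs ∷ʳ b)) T′ (+ suc (suc (length cs))) (program (cs ∷ʳ b)) 1
learning-run bits cs b drawn =
  let T₁ , T₁≗ , scan = scan-input bits cs (length cs) ≤-refl
      T′ , tail = learn-tail bits cs b {T₁} {0} drawn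
                    (trans (T₁≗ _) (input-blank {length cs} ≤-refl))
                    (trans (T₁≗ _) (input-blank {length cs} (n≤1+n _)))
  in T′ , run⇒iter (scan ▸▸ tail)

-- Every machine of the family evolves by storing one more bit: for 𝔔(x) the
-- run on the empty input is checked by evaluation; otherwise it is the
-- learning run on a^(length cs).
evolves-∷ʳ : ∀ cs b → Evolves (𝔔 cs) (𝔔 (cs ∷ʳ b))
evolves-∷ʳ []       false = evolves-via (inputTape-bounded 0) 0ℤ (λ _ → false) 6 refl refl refl
evolves-∷ʳ []       true  = evolves-via (inputTape-bounded 0) 0ℤ (λ _ → true) 6 refl refl refl
evolves-∷ʳ (c ∷ cs) b =
  let _ , run = learning-run (λ _ → b) (c ∷ cs) b refl
  in evolves-via (inputTape-bounded (length (c ∷ cs))) 0ℤ (λ _ → b) (suc (length (c ∷ cs) + 5))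
                 (cong Config.state run) (cong Config.nQ run) (cong Config.instrs run)

mainTheorem2 : (f : ℕ → Bool) →
    (∀ k → Evolves (𝔔 (applyUpTo f k)) (𝔔 (applyUpTo f (suc k))))
    × (∀ n k → n ≤ k →
        (InLanguage (𝔔 (applyUpTo f (suc k))) n ⇔ f n ≡ true)
        × (NotInLanguage (𝔔 (applyUpTo f (suc k))) n ⇔ f n ≡ false))
mainTheorem2 f = evolutionary-path , λ n k n≤k → language f k n n≤k true , language f k n n≤k false
  where
  evolutionary-path : ∀ k → Evolves (𝔔 (applyUpTo f k)) (𝔔 (applyUpTo f (suc k)))
  evolutionary-path k =
    subst (Evolves (𝔔 (applyUpTo f k)) ∘ 𝔔) (applyUpTo-∷ʳ f k) (evolves-∷ʳ (applyUpTo f k) (f k))
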